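{- For all positive integers $n,k$ with $n\ge 2k+1$: $$d_{n+1,k}=-\frac{2(n-k+1)d_{n-1,k}-(3n-5k+4)d_{n,k}}{n-2k+1},$$ $$d_{n-1,k-1}=-\frac{2(n-k+1)d_{n-1,k}-(2n-3k+3)d_{n,k}}{n-2k+1},$$ $$d_{n-1,k+1}=\frac{\big(4n^2+(4-13k)n+11k^2-5k\big)d_{n-1,k}-\big(2n^2-7nk+6k^2\big)d_{n,k}}{2k(n-k)}.$$
   Context: For integers $n\ge0$, $k\ge0$, $d_{n,k}:=\sum_{i=2k}^{n}(n-i+1)\binom{n-k+1}{i-2k}$ (an empty sum being $0$). -}

module Defs where

open import Data.Nat using (ℕ; suc; _+_; _*_; _∸_)
open import Data.Nat.Combinatorics using (_C_)
open import Data.List using (map; upTo)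
open import Data.Nat.ListAction using (sum)

-- sumFromTo a b f = Σ_{i=a}^{b} f i   (empty sum = 0 when b < a)
sumFromTo : ℕ → ℕ → (ℕ → ℕ) → ℕ
sumFromTo a b f = sum (map (λ j → f (a + j)) (upTo (suc b ∸ a)))

-- d n k = Σ_{i=2k}^{n} (n-i+1) * binom(n-k+1, i-2k)
-- (in the range 2k ≤ i ≤ n, the truncated subtractions are exact)
d : ℕ → ℕ → ℕ
d n k = sumFromTo (2 * k) n (λ i → (n ∸ i + 1) * ((n ∸ k + 1) C (i ∸ 2 * k)))

{-# OPTIONS --safe #-}
-- Writing n + 1 = 2k + l, the sum defining d n k is Σ_{j<l} (l − j)·C(l+k, j), the iterated
-- partial row sum D k l = binomSum₂ (l + k) l = Σ_{i≤l} binomSum (l + k) i of Pascal's triangle.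
-- By induction on l and the absorption identity (j+1)·C(m, j+1) = (m − j)·C(m, j), it has a closed
-- form in terms of the ordinary partial row sum: 2·binomSum₂ m l = (2l − m)·binomSum m l + l·C(m, l).
-- Comparing this closed form at three neighbouring points gives the contiguity relation
--   (l+1)·D(k−1, l+2) + 2(k+l+1)·D(k, l) = (k+2l+3)·D(k, l+1).
-- The second identity is a rearrangement of it, the first adds Pascal's rule
-- D(k, l+1) = D(k, l) + D(k−1, l+1), and the third combines two instances of it at k + 1 with
-- Pascal's rule.
module Submission where

open import Defs
open import Data.Nat using (ℕ; _≤_; _∸_)
open import Data.Product using (_×_)
open import Relation.Binary.PropositionalEquality using (_≡_)

open import Data.Nat using (zero; suc; _<_; s≤s; z≤n)
open import Data.Nat.Properties using (+-suc)
open import Data.Nat.Combinatorics using (_C_; nC1≡n; nCk+nC[k+1]≡[n+1]C[k+1])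
open import Data.Product using (_,_; ∃)
open import Data.List using ([]; _∷_)
open import Relation.Binary.PropositionalEquality
  using (refl; sym; trans; cong; cong₂; module ≡-Reasoning)
import Data.Nat as ℕ

module BinomialSums where
  open import Data.Nat using (_+_; _*_)
  open import Data.Nat.Properties
    using ( suc-injective; ≤-reflexive; ≤-trans; <⇒≤; m<n⇒m<1+n; n<1+n; n≤1+n; +-comm; +-assoc
          ; +-identityʳ; *-zeroʳ; *-identityʳ; *-distribˡ-+; +-∸-assoc; m+n∸n≡m; m+n∸m≡n
          ; [m+n]∸[m+o]≡n∸o; m≤n⇒m∸n≡0; m≤n⇒∃[o]m+o≡n; +-commutativeSemigroup )
  open import Data.List using (applyUpTo; upTo; map; [_]; _++_)
  open import Data.List.Properties using (applyUpTo-∷ʳ; map-upTo)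
  open import Data.Nat.ListAction using (sum)
  open import Data.Nat.ListAction.Properties using (sum-++)
  open import Function using (_∘_)
  open import Data.Nat.Tactic.RingSolver using (solve)
  open import Algebra.Properties.CommutativeSemigroup +-commutativeSemigroup using (interchange)
  open ≡-Reasoning

  prefixSum : (ℕ → ℕ) → ℕ → ℕ
  prefixSum f zero    = 0
  prefixSum f (suc n) = prefixSum f n + f n

  sum-applyUpTo : ∀ f n → sum (applyUpTo f n) ≡ prefixSum f n
  sum-applyUpTo f zero    = refl
  sum-applyUpTo f (suc n) = begin
    sum (applyUpTo f (suc n))       ≡⟨ cong sum (applyUpTo-∷ʳ f n) ⟨
    sum (applyUpTo f n ++ [ f n ])  ≡⟨ sum-++ (applyUpTo f n) [ f n ] ⟩
    sum (applyUpTo f n) + (f n + 0) ≡⟨ cong₂ _+_ (sum-applyUpTo f n) (+-identityʳ (f n)) ⟩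
    prefixSum f n + f n             ∎

  prefixSum-cong : ∀ {f g} n → (∀ {j} → j < n → f j ≡ g j) → prefixSum f n ≡ prefixSum g n
  prefixSum-cong zero    f≡g = refl
  prefixSum-cong (suc n) f≡g = cong₂ _+_ (prefixSum-cong n (f≡g ∘ m<n⇒m<1+n)) (f≡g (n<1+n n))

  prefixSum-+ : ∀ f g n → prefixSum (λ j → f j + g j) n ≡ prefixSum f n + prefixSum g n
  prefixSum-+ f g zero    = refl
  prefixSum-+ f g (suc n) = begin
    prefixSum (λ j → f j + g j) n + (f n + g n)
      ≡⟨ cong (_+ (f n + g n)) (prefixSum-+ f g n) ⟩
    prefixSum f n + prefixSum g n + (f n + g n)
      ≡⟨ interchange (prefixSum f n) (prefixSum g n) (f n) (g n) ⟩
    prefixSum f n + f n + (prefixSum g n + g n) ∎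

  prefixSum-weighted : ∀ f n → prefixSum (λ j → (n ∸ j) * f j) n ≡ prefixSum (prefixSum f) (suc n)
  prefixSum-weighted f zero    = refl
  prefixSum-weighted f (suc n) = begin
    prefixSum (λ j → (suc n ∸ j) * f j) n + (suc n ∸ n) * f n
      ≡⟨ cong₂ _+_ (prefixSum-cong n weight-suc) (cong (_* f n) (m+n∸n≡m 1 n)) ⟩
    prefixSum (λ j → f j + (n ∸ j) * f j) n + (f n + 0)
      ≡⟨ cong₂ _+_ (prefixSum-+ f _ n) (+-identityʳ (f n)) ⟩
    prefixSum f n + prefixSum (λ j → (n ∸ j) * f j) n + f n
      ≡⟨ cong (λ s → prefixSum f n + s + f n) (prefixSum-weighted f n) ⟩
    prefixSum f n + prefixSum (prefixSum f) (suc n) + f n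
      ≡⟨ cong (_+ f n) (+-comm (prefixSum f n) _) ⟩
    prefixSum (prefixSum f) (suc n) + prefixSum f n + f n
      ≡⟨ +-assoc (prefixSum (prefixSum f) (suc n)) (prefixSum f n) (f n) ⟩
    prefixSum (prefixSum f) (suc (suc n)) ∎
    where
    weight-suc : ∀ {j} → j < n → (suc n ∸ j) * f j ≡ f j + (n ∸ j) * f j
    weight-suc {j} j<n = cong (_* f j) (+-∸-assoc 1 (<⇒≤ j<n))

  record IsPascal (a : ℕ → ℕ → ℕ) : Set where
    field
      edge : ∀ m → a (suc m) 0 ≡ a m 0
      step : ∀ m j → a (suc m) (suc j) ≡ a m j + a m (suc j)

  C-isPascal : IsPascal _C_
  C-isPascal = record
    { edge = λ _ → refl
    ; step = λ m j → sym (nCk+nC[k+1]≡[n+1]C[k+1] m j)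
    }

  prefixSum-isPascal : ∀ {a} → IsPascal a → IsPascal (λ m → prefixSum (a m))
  prefixSum-isPascal {a} a-isPascal = record { edge = λ _ → refl ; step = step }
    where
    open IsPascal a-isPascal renaming (step to a-step)
    step : ∀ m j → prefixSum (a (suc m)) (suc j) ≡ prefixSum (a m) j + prefixSum (a m) (suc j)
    step m zero    = edge m
    step m (suc j) = begin
      prefixSum (a (suc m)) (suc j) + a (suc m) (suc j)
        ≡⟨ cong₂ _+_ (step m j) (a-step m j) ⟩
      prefixSum (a m) j + prefixSum (a m) (suc j) + (a m j + a m (suc j))
        ≡⟨ interchange (prefixSum (a m) j) _ _ _ ⟩
      prefixSum (a m) (suc j) + prefixSum (a m) (suc (suc j)) ∎

  [1+k]*[1+n]C[1+k]≡[1+n]*nCk : ∀ n k → suc k * (suc n C suc k) ≡ suc n * (n C k)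
  [1+k]*[1+n]C[1+k]≡[1+n]*nCk zero    zero    = refl
  [1+k]*[1+n]C[1+k]≡[1+n]*nCk zero    (suc k) = *-zeroʳ (suc (suc k))
  [1+k]*[1+n]C[1+k]≡[1+n]*nCk (suc n) zero    =
    trans (+-identityʳ _) (trans (nC1≡n (suc (suc n))) (sym (*-identityʳ (suc (suc n)))))
  [1+k]*[1+n]C[1+k]≡[1+n]*nCk (suc n) (suc k) = begin
    suc (suc k) * (suc (suc n) C suc (suc k))
      ≡⟨ cong (suc (suc k) *_) (IsPascal.step C-isPascal (suc n) (suc k)) ⟩
    suc (suc k) * (a + b)
      ≡⟨ *-distribˡ-+ (suc (suc k)) a b ⟩
    a + suc k * a + suc (suc k) * b
      ≡⟨ +-assoc a _ _ ⟩
    a + (suc k * a + suc (suc k) * b)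
      ≡⟨ cong (a +_) (cong₂ _+_ ([1+k]*[1+n]C[1+k]≡[1+n]*nCk n k)
                                ([1+k]*[1+n]C[1+k]≡[1+n]*nCk n (suc k))) ⟩
    a + (suc n * (n C k) + suc n * (n C suc k))
      ≡⟨ cong (a +_) (*-distribˡ-+ (suc n) (n C k) (n C suc k)) ⟨
    a + suc n * (n C k + n C suc k)
      ≡⟨ cong (λ c → a + suc n * c) (IsPascal.step C-isPascal n k) ⟨
    suc (suc n) * a ∎
    where
    a b : ℕ
    a = suc n C suc k
    b = suc n C suc (suc k)

  binomSum : ℕ → ℕ → ℕ
  binomSum m = prefixSum (m C_)

  binomSum₂ : ℕ → ℕ → ℕ
  binomSum₂ m l = prefixSum (binomSum m) (suc l)

  binomSum-pascal : ∀ m l → binomSum (suc m) (suc l) ≡ binomSum m l + binomSum m (suc l)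
  binomSum-pascal = IsPascal.step (prefixSum-isPascal C-isPascal)

  binomSum₂-pascal : ∀ m l → binomSum₂ (suc m) (suc l) ≡ binomSum₂ m l + binomSum₂ m (suc l)
  binomSum₂-pascal m l = IsPascal.step (prefixSum-isPascal (prefixSum-isPascal C-isPascal)) m (suc l)

  D : ℕ → ℕ → ℕ
  D k l = binomSum₂ (l + k) l

  D-pascal : ∀ j l → D (suc j) (suc l) ≡ D (suc j) l + D j (suc l)
  D-pascal j l =
    trans (binomSum₂-pascal (l + suc j) l) (cong (λ m → D (suc j) l + binomSum₂ m (suc l)) (+-suc l j))

  d-summand : ℕ → ℕ → ℕ → ℕ
  d-summand n k j = (n ∸ (2 * k + j) + 1) * ((n ∸ k + 1) C (2 * k + j ∸ 2 * k))

  d≡0 : ∀ {n k} → suc n ≤ 2 * k → d n k ≡ 0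
  d≡0 {n} {k} n<2k = cong (λ L → sum (map (d-summand n k) (upTo L))) (m≤n⇒m∸n≡0 n<2k)

  2*k≡k+k : ∀ k → 2 * k ≡ k + k
  2*k≡k+k k = cong (k +_) (+-identityʳ k)

  d-diagonal : ∀ k l → d (k + k + l) k ≡ D k (suc l)
  d-diagonal k l = begin
    d n k
      ≡⟨ cong (λ L → sum (map (d-summand n k) (upTo L))) length≡ ⟩
    sum (map (d-summand n k) (upTo (suc l)))
      ≡⟨ cong sum (map-upTo (d-summand n k) (suc l)) ⟩
    sum (applyUpTo (d-summand n k) (suc l))
      ≡⟨ sum-applyUpTo (d-summand n k) (suc l) ⟩
    prefixSum (d-summand n k) (suc l)
      ≡⟨ prefixSum-cong (suc l) summand≡ ⟩
    prefixSum (λ j → (suc l ∸ j) * ((suc l + k) C j)) (suc l)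
      ≡⟨ prefixSum-weighted _ (suc l) ⟩
    D k (suc l) ∎
    where
    n : ℕ
    n = k + k + l
    length≡ : suc n ∸ 2 * k ≡ suc l
    length≡ = begin
      suc n ∸ 2 * k             ≡⟨ cong₂ _∸_ (sym (+-suc (k + k) l)) (2*k≡k+k k) ⟩
      k + k + suc l ∸ (k + k)   ≡⟨ m+n∸m≡n (k + k) (suc l) ⟩
      suc l                     ∎
    weight≡ : ∀ {j} → j ≤ l → n ∸ (2 * k + j) + 1 ≡ suc l ∸ j
    weight≡ {j} j≤l = begin
      n ∸ (2 * k + j) + 1       ≡⟨ cong (λ t → n ∸ (t + j) + 1) (2*k≡k+k k) ⟩
      n ∸ (k + k + j) + 1       ≡⟨ cong (_+ 1) ([m+n]∸[m+o]≡n∸o (k + k) l j) ⟩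
      l ∸ j + 1                 ≡⟨ +-comm (l ∸ j) 1 ⟩
      suc (l ∸ j)               ≡⟨ +-∸-assoc 1 j≤l ⟨
      suc l ∸ j                 ∎
    top≡ : n ∸ k + 1 ≡ suc l + k
    top≡ = begin
      n ∸ k + 1                 ≡⟨ cong (λ t → t ∸ k + 1) (+-assoc k k l) ⟩
      k + (k + l) ∸ k + 1       ≡⟨ cong (_+ 1) (m+n∸m≡n k (k + l)) ⟩
      k + l + 1                 ≡⟨ +-comm (k + l) 1 ⟩
      suc (k + l)               ≡⟨ cong suc (+-comm k l) ⟩
      suc l + k                 ∎
    summand≡ : ∀ {j} → j < suc l → d-summand n k j ≡ (suc l ∸ j) * ((suc l + k) C j)
    summand≡ {j} (s≤s j≤l) = cong₂ _*_ (weight≡ j≤l) (cong₂ _C_ top≡ (m+n∸m≡n (2 * k) j))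

  d≡D : ∀ {n k} l → suc n ≡ k + k + l → d n k ≡ D k l
  d≡D {n} {k} zero    eq = d≡0 {n} {k} (≤-reflexive (trans eq (+-assoc k k 0)))
  d≡D {n} {k} (suc l) eq with suc-injective (trans eq (+-suc (k + k) l))
  ... | refl = d-diagonal k l

  2k+1≤n⇒∃[r]n≡k+k+1+r : ∀ {n k} → 2 * k + 1 ≤ n → ∃ λ r → n ≡ k + k + suc r
  2k+1≤n⇒∃[r]n≡k+k+1+r {n} {k} 2k+1≤n with m≤n⇒∃[o]m+o≡n 2k+1≤n
  ... | r , refl = r , trans (+-assoc (2 * k) 1 r) (cong (_+ suc r) (2*k≡k+k k))

  d[n-1,k]≡D : ∀ j r → d (suc j + suc j + suc r ∸ 1) (suc j) ≡ D (suc j) (suc r)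
  d[n-1,k]≡D j r = d≡D (suc r) refl

  d[n,k]≡D : ∀ j r → d (suc j + suc j + suc r) (suc j) ≡ D (suc j) (suc (suc r))
  d[n,k]≡D j r = d≡D (suc (suc r)) (sym (+-suc (suc j + suc j) (suc r)))

  d[n+1,k]≡D : ∀ j r → d (suc j + suc j + suc r + 1) (suc j) ≡ D (suc j) (suc (suc (suc r)))
  d[n+1,k]≡D j r = d≡D (suc (suc (suc r))) (solve (j ∷ r ∷ []))

  d[n-1,k-1]≡D : ∀ j r → d (suc j + suc j + suc r ∸ 1) j ≡ D j (suc (suc (suc r)))
  d[n-1,k-1]≡D j r = d≡D (suc (suc (suc r))) n≡
    where
    n≡ : suc j + suc j + suc r ≡ j + j + suc (suc (suc r))
    n≡ = solve (j ∷ r ∷ [])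

  -- At r = 0 the truncated r ∸ 1 is 0, and both sides vanish.
  d[n-1,k+1]≡D : ∀ j r → d (suc j + suc j + suc r ∸ 1) (suc j + 1) ≡ D (suc (suc j)) (r ∸ 1)
  d[n-1,k+1]≡D j zero    = d≡0 {k = suc j + 1} (≤-trans (n≤1+n _) (≤-reflexive n≡))
    where
    n≡ : suc (suc j + suc j + 1) ≡ 2 * (suc j + 1)
    n≡ = solve (j ∷ [])
  d[n-1,k+1]≡D j (suc q) = trans (d≡D q n≡) (cong (λ k → D k q) (+-comm (suc j) 1))
    where
    n≡ : suc j + suc j + suc (suc q) ≡ suc j + 1 + (suc j + 1) + q
    n≡ = solve (j ∷ q ∷ [])

open BinomialSums

open import Data.Integer using (ℤ; +_; _+_; _-_; _*_)
open import Data.Integer.Properties using (pos-*; *-cancelˡ-≡)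
open import Data.Integer.Tactic.RingSolver using (solve; solve-∀)
open ≡-Reasoning

[1+k]*nC[1+k]≡[n-k]*nCk : ∀ n k → + suc k * + (n C suc k) ≡ (+ n - + k) * + (n C k)
[1+k]*nC[1+k]≡[n-k]*nCk n k = cancel (+ n) (+ k) (+ (n C k)) (+ (n C suc k)) absorption
  where
  absorption : + suc k * (+ (n C k) + + (n C suc k)) ≡ + suc n * + (n C k)
  absorption = trans (cong (λ c → + suc k * + c) (sym (IsPascal.step C-isPascal n k)))
    (trans (sym (pos-* (suc k) (suc n C suc k)))
    (trans (cong +_ ([1+k]*[1+n]C[1+k]≡[1+n]*nCk n k)) (pos-* (suc n) (n C k))))
  cancel : ∀ N K c c₁ → (+ 1 + K) * (c + c₁) ≡ (+ 1 + N) * c → (+ 1 + K) * c₁ ≡ (N - K) * c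
  cancel N K c c₁ h = begin
    (+ 1 + K) * c₁                       ≡⟨ solve (K ∷ c ∷ c₁ ∷ []) ⟩
    (+ 1 + K) * (c + c₁) - (+ 1 + K) * c ≡⟨ cong (_- (+ 1 + K) * c) h ⟩
    (+ 1 + N) * c - (+ 1 + K) * c        ≡⟨ solve (N ∷ K ∷ c ∷ []) ⟩
    (N - K) * c                          ∎

binomSum₂-closedForm : ∀ m l →
  + 2 * + binomSum₂ m l ≡ (+ 2 * + l - + m) * + binomSum m l + + l * + (m C l)
binomSum₂-closedForm m zero    = base (+ m) (+ (m C 0))
  where
  base : ∀ M c → + 2 * + 0 ≡ (+ 2 * + 0 - M) * + 0 + + 0 * c
  base = solve-∀
binomSum₂-closedForm m (suc l) =
  step (+ m) (+ l) (+ binomSum₂ m l) (+ binomSum m l) (+ (m C l)) (+ (m C suc l))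
    (binomSum₂-closedForm m l) ([1+k]*nC[1+k]≡[n-k]*nCk m l)
  where
  step : ∀ M L x p c c₁ → + 2 * x ≡ (+ 2 * L - M) * p + L * c → (+ 1 + L) * c₁ ≡ (M - L) * c →
         + 2 * (x + (p + c)) ≡ (+ 2 * (+ 1 + L) - M) * (p + c) + (+ 1 + L) * c₁
  step M L x p c c₁ hx hc = begin
    + 2 * (x + (p + c))                               ≡⟨ solve (x ∷ p ∷ c ∷ []) ⟩
    + 2 * x + + 2 * (p + c)                           ≡⟨ cong (_+ + 2 * (p + c)) hx ⟩
    (+ 2 * L - M) * p + L * c + + 2 * (p + c)         ≡⟨ solve (M ∷ L ∷ p ∷ c ∷ []) ⟩
    (+ 2 * (+ 1 + L) - M) * (p + c) + (M - L) * c
      ≡⟨ cong (λ t → (+ 2 * (+ 1 + L) - M) * (p + c) + t) hc ⟨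
    (+ 2 * (+ 1 + L) - M) * (p + c) + (+ 1 + L) * c₁ ∎

binomSum₂-suc-suc : ∀ m l → + 2 * + binomSum₂ (suc m) (suc l)
  ≡ (+ 2 * (+ 1 + + l) - (+ 1 + + m)) * (+ binomSum m l + + binomSum m (suc l)) + (+ 1 + + m) * + (m C l)
binomSum₂-suc-suc m l = trans (binomSum₂-closedForm (suc m) (suc l))
  (cong₂ (λ s t → (+ 2 * + suc l - + suc m) * + s + t) (binomSum-pascal m l) absorption)
  where
  absorption : + suc l * + (suc m C suc l) ≡ + suc m * + (m C l)
  absorption = trans (sym (pos-* (suc l) (suc m C suc l)))
    (trans (cong +_ ([1+k]*[1+n]C[1+k]≡[1+n]*nCk m l)) (pos-* (suc m) (m C l)))

D-contiguity : ∀ j l → let k = suc j in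
  (+ l + + 1) * + D j (suc (suc l)) + + 2 * (+ k + + l + + 1) * + D k l
    ≡ (+ k + + 2 * + l + + 3) * + D k (suc l)
D-contiguity j l = contiguity (+ suc j) (+ l) (+ binomSum m l) (+ (m C l)) (+ (m C suc l))
  (binomSum₂-closedForm m l)
  (binomSum₂-suc-suc m l)
  (trans (cong (λ m′ → + 2 * + binomSum₂ (suc m′) (suc (suc l))) (sym (+-suc l j)))
         (binomSum₂-suc-suc m (suc l)))
  ([1+k]*nC[1+k]≡[n-k]*nCk m l)
  where
  m : ℕ
  m = l ℕ.+ suc j
  contiguity : ∀ K L p c c₁ {x y w} →
    + 2 * x ≡ (+ 2 * L - (L + K)) * p + L * c →
    + 2 * y ≡ (+ 2 * (+ 1 + L) - (+ 1 + (L + K))) * (p + (p + c)) + (+ 1 + (L + K)) * c →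
    + 2 * w ≡ (+ 2 * (+ 1 + (+ 1 + L)) - (+ 1 + (L + K))) * (p + c + (p + c + c₁)) + (+ 1 + (L + K)) * c₁ →
    (+ 1 + L) * c₁ ≡ (L + K - L) * c →
    (L + + 1) * w + + 2 * (K + L + + 1) * x ≡ (K + + 2 * L + + 3) * y
  contiguity K L p c c₁ {x} {y} {w} hx hy hw hc = *-cancelˡ-≡ (+ 2) _ _ (begin
    + 2 * ((L + + 1) * w + + 2 * (K + L + + 1) * x)
      ≡⟨ solve (K ∷ L ∷ x ∷ w ∷ []) ⟩
    (L + + 1) * (+ 2 * w) + + 2 * (K + L + + 1) * (+ 2 * x)
      ≡⟨ cong₂ (λ s t → (L + + 1) * s + + 2 * (K + L + + 1) * t) hw hx ⟩
    (L + + 1) * ((+ 2 * (+ 1 + (+ 1 + L)) - (+ 1 + (L + K))) * (p + c + (p + c + c₁)) + (+ 1 + (L + K)) * c₁)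
      + + 2 * (K + L + + 1) * ((+ 2 * L - (L + K)) * p + L * c)
      ≡⟨ solve (K ∷ L ∷ p ∷ c ∷ c₁ ∷ []) ⟩
    (L + + 1) * (+ 3 + L - K) * (+ 2 * (p + c)) + + 2 * (K + L + + 1) * ((L - K) * p + L * c)
      + + 2 * (+ 2 + L) * ((+ 1 + L) * c₁)
      ≡⟨ cong (λ t → (L + + 1) * (+ 3 + L - K) * (+ 2 * (p + c)) + + 2 * (K + L + + 1) * ((L - K) * p + L * c)
                     + + 2 * (+ 2 + L) * t) hc ⟩
    (L + + 1) * (+ 3 + L - K) * (+ 2 * (p + c)) + + 2 * (K + L + + 1) * ((L - K) * p + L * c)
      + + 2 * (+ 2 + L) * ((L + K - L) * c)
      ≡⟨ solve (K ∷ L ∷ p ∷ c ∷ []) ⟩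
    (K + + 2 * L + + 3) * ((+ 2 * (+ 1 + L) - (+ 1 + (L + K))) * (p + (p + c)) + (+ 1 + (L + K)) * c)
      ≡⟨ cong ((K + + 2 * L + + 3) *_) hy ⟨
    (K + + 2 * L + + 3) * (+ 2 * y)
      ≡⟨ solve (K ∷ L ∷ y ∷ []) ⟩
    + 2 * ((K + + 2 * L + + 3) * y) ∎)

D-recurrence₂ : ∀ j l → let k = suc j ; N = + k + + k + + l in
  (N - + 2 * + k + + 1) * + D j (suc (suc l))
    ≡ (+ 2 * N - + 3 * + k + + 3) * + D k (suc l) - + 2 * (N - + k + + 1) * + D k l
D-recurrence₂ j l = reshape (+ suc j) (+ l) (D-contiguity j l)
  where
  reshape : ∀ K L {x y w} → (L + + 1) * w + + 2 * (K + L + + 1) * x ≡ (K + + 2 * L + + 3) * y →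
    (K + K + L - + 2 * K + + 1) * w
      ≡ (+ 2 * (K + K + L) - + 3 * K + + 3) * y - + 2 * (K + K + L - K + + 1) * x
  reshape K L {x} {y} {w} h = begin
    _ ≡⟨ solve (K ∷ L ∷ x ∷ w ∷ []) ⟩
    (L + + 1) * w + + 2 * (K + L + + 1) * x - + 2 * (K + K + L - K + + 1) * x
      ≡⟨ cong (_- + 2 * (K + K + L - K + + 1) * x) h ⟩
    (K + + 2 * L + + 3) * y - + 2 * (K + K + L - K + + 1) * x
      ≡⟨ solve (K ∷ L ∷ x ∷ y ∷ []) ⟩
    _ ∎

D-recurrence₁ : ∀ j l → let k = suc j ; N = + k + + k + + l in
  (N - + 2 * + k + + 1) * + D k (suc (suc l))
    ≡ (+ 3 * N - + 5 * + k + + 4) * + D k (suc l) - + 2 * (N - + k + + 1) * + D k l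
D-recurrence₁ j l rewrite D-pascal j (suc l) = add-pascal (+ suc j) (+ l) (D-contiguity j l)
  where
  add-pascal : ∀ K L {x y w} → (L + + 1) * w + + 2 * (K + L + + 1) * x ≡ (K + + 2 * L + + 3) * y →
    (K + K + L - + 2 * K + + 1) * (y + w)
      ≡ (+ 3 * (K + K + L) - + 5 * K + + 4) * y - + 2 * (K + K + L - K + + 1) * x
  add-pascal K L {x} {y} {w} h = begin
    _ ≡⟨ solve (K ∷ L ∷ x ∷ y ∷ w ∷ []) ⟩
    (L + + 1) * y + ((L + + 1) * w + + 2 * (K + L + + 1) * x) - + 2 * (K + K + L - K + + 1) * x
      ≡⟨ cong (λ t → (L + + 1) * y + t - + 2 * (K + K + L - K + + 1) * x) h ⟩
    (L + + 1) * y + (K + + 2 * L + + 3) * y - + 2 * (K + K + L - K + + 1) * x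
      ≡⟨ solve (K ∷ L ∷ x ∷ y ∷ []) ⟩
    _ ∎

D-recurrence₃ : ∀ j r → let k = suc j ; N = + k + + k + + suc r in
  + 2 * + k * (N - + k) * + D (suc k) (r ∸ 1)
    ≡ (+ 4 * N * N + (+ 4 - + 13 * + k) * N + + 11 * + k * + k - + 5 * + k) * + D k (suc r)
      - (+ 2 * N * N - + 7 * N * + k + + 6 * + k * + k) * + D k (suc (suc r))
D-recurrence₃ j zero rewrite D-pascal j 1 =
  sym (combine₀ (+ suc j) {+ D (suc j) 1} {+ D j 2} (D-contiguity j 0))
  where
  combine₀ : ∀ K {x w} → (+ 0 + + 1) * w + + 2 * (K + + 0 + + 1) * + 0 ≡ (K + + 2 * + 0 + + 3) * x →
    (+ 4 * (K + K + + 1) * (K + K + + 1) + (+ 4 - + 13 * K) * (K + K + + 1) + + 11 * K * K - + 5 * K) * x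
      - (+ 2 * (K + K + + 1) * (K + K + + 1) - + 7 * (K + K + + 1) * K + + 6 * K * K) * (x + w)
      ≡ + 2 * K * (K + K + + 1 - K) * + 0
  combine₀ K {x} {w} h = begin
    _ ≡⟨ solve (K ∷ x ∷ w ∷ []) ⟩
    (K + + 2) * ((K + + 3) * x - ((+ 0 + + 1) * w + + 2 * (K + + 0 + + 1) * + 0))
      ≡⟨ cong (λ t → (K + + 2) * ((K + + 3) * x - t)) h ⟩
    (K + + 2) * ((K + + 3) * x - (K + + 2 * + 0 + + 3) * x)
      ≡⟨ solve (K ∷ x ∷ []) ⟩
    _ ∎
D-recurrence₃ j (suc q) =
  sym (combine (+ suc j) (+ q) (D-contiguity (suc j) q) (D-contiguity (suc j) (suc q))
               (cong +_ (D-pascal (suc j) (suc q))))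
  where
  combine : ∀ K Q {u x y z s} →
    (Q + + 1) * x + + 2 * (+ 1 + K + Q + + 1) * u ≡ (+ 1 + K + + 2 * Q + + 3) * z →
    (+ 1 + Q + + 1) * y + + 2 * (+ 1 + K + (+ 1 + Q) + + 1) * z ≡ (+ 1 + K + + 2 * (+ 1 + Q) + + 3) * s →
    s ≡ z + x →
    (+ 4 * (K + K + (+ 1 + (+ 1 + Q))) * (K + K + (+ 1 + (+ 1 + Q)))
        + (+ 4 - + 13 * K) * (K + K + (+ 1 + (+ 1 + Q))) + + 11 * K * K - + 5 * K) * x
      - (+ 2 * (K + K + (+ 1 + (+ 1 + Q))) * (K + K + (+ 1 + (+ 1 + Q)))
        - + 7 * (K + K + (+ 1 + (+ 1 + Q))) * K + + 6 * K * K) * y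
      ≡ + 2 * K * (K + K + (+ 1 + (+ 1 + Q)) - K) * u
  -- 2n² − 7nk + 6k² = (2n − 3k)(n − 2k), and here 2n − 3k = k + 2q + 4.
  combine K Q {u} {x} {y} {z} h₁ h₂ refl = begin
    _ ≡⟨ solve (K ∷ Q ∷ x ∷ y ∷ z ∷ []) ⟩
    (K + + 2 * Q + + 4) * (+ 2 * (+ 1 + K + (+ 1 + Q) + + 1) * z
      - ((+ 1 + Q + + 1) * y + + 2 * (+ 1 + K + (+ 1 + Q) + + 1) * z))
      + ((K + + 2 * Q + + 4) * (K + + 2 * Q + + 6) - K * (Q + + 1)) * x
      ≡⟨ cong (λ t → (K + + 2 * Q + + 4) * (+ 2 * (+ 1 + K + (+ 1 + Q) + + 1) * z - t)
                     + ((K + + 2 * Q + + 4) * (K + + 2 * Q + + 6) - K * (Q + + 1)) * x) h₂ ⟩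
    (K + + 2 * Q + + 4)
      * (+ 2 * (+ 1 + K + (+ 1 + Q) + + 1) * z - (+ 1 + K + + 2 * (+ 1 + Q) + + 3) * (z + x))
      + ((K + + 2 * Q + + 4) * (K + + 2 * Q + + 6) - K * (Q + + 1)) * x
      ≡⟨ solve (K ∷ Q ∷ x ∷ z ∷ []) ⟩
    K * ((+ 1 + K + + 2 * Q + + 3) * z) - K * ((Q + + 1) * x)
      ≡⟨ cong (λ t → K * t - K * ((Q + + 1) * x)) h₁ ⟨
    K * ((Q + + 1) * x + + 2 * (+ 1 + K + Q + + 1) * u) - K * ((Q + + 1) * x)
      ≡⟨ solve (K ∷ Q ∷ u ∷ x ∷ []) ⟩
    _ ∎

lemma5p2 : (n k : ℕ) → 1 ≤ k → 2 Data.Nat.* k Data.Nat.+ 1 ≤ n →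
    ((+ n - + 2 * + k + + 1) * + d (n Data.Nat.+ 1) k
        ≡ (+ 3 * + n - + 5 * + k + + 4) * + d n k - + 2 * (+ n - + k + + 1) * + d (n ∸ 1) k)
    × ((+ n - + 2 * + k + + 1) * + d (n ∸ 1) (k ∸ 1)
        ≡ (+ 2 * + n - + 3 * + k + + 3) * + d n k - + 2 * (+ n - + k + + 1) * + d (n ∸ 1) k)
    × (+ 2 * + k * (+ n - + k) * + d (n ∸ 1) (k Data.Nat.+ 1)
        ≡ (+ 4 * + n * + n + (+ 4 - + 13 * + k) * + n + + 11 * + k * + k - + 5 * + k) * + d (n ∸ 1) k
          - (+ 2 * + n * + n - + 7 * + n * + k + + 6 * + k * + k) * + d n k)
lemma5p2 n (suc j) (s≤s z≤n) 2k+1≤n with 2k+1≤n⇒∃[r]n≡k+k+1+r {k = suc j} 2k+1≤n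
... | r , refl
  rewrite d[n+1,k]≡D j r | d[n,k]≡D j r | d[n-1,k]≡D j r | d[n-1,k-1]≡D j r | d[n-1,k+1]≡D j r
  = D-recurrence₁ j (suc r) , D-recurrence₂ j (suc r) , D-recurrence₃ j r
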